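{- Let $f\in\mathrm{RPP}^k$ (with any derivation used to build $\mathrm{isos}(f)$) and $n_1,\dots,n_k\in\mathbb{Z}$ with $f(n_1,\dots,n_k)=(m_1,\dots,m_k)$. Then $\mathrm{isos}(f)\,(\overline{n_1},\dots,\overline{n_k})\to^*(\overline{m_1},\dots,\overline{m_k})$.
   Context: RPP (Reversible Primitive Permutations): $\mathrm{RPP}^k$ is a set of functions $\mathbb{Z}^k\to\mathbb{Z}^k$ defined inductively: the primitives $S,P,\mathrm{Id},\mathrm{Sign}\in\mathrm{RPP}^1$ with $S(x)=x+1$, $P(x)=x-1$, $\mathrm{Id}(x)=x$, $\mathrm{Sign}(x)=-x$, and $\mathcal{X}\in\mathrm{RPP}^2$ with $\mathcal{X}(x,y)=(y,x)$; and for $f,g,h\in\mathrm{RPP}^k$, $j\in\mathrm{RPP}^l$: sequential composition $f;g\in\mathrm{RPP}^k$ ($x\mapsto g(f(x))$), parallel composition $f\parallel j\in\mathrm{RPP}^{k+l}$ ($(\vec x,\vec y)\mapsto(f(\vec x),j(\vec y))$), iteration $\mathbf{It}[f]\in\mathrm{RPP}^{k+1}$ with $\mathbf{It}[f](\vec x,x)=(f^{|x|}(\vec x),x)$, and selection $\mathbf{If}[f,g,h]\in\mathrm{RPP}^{k+1}$ with $\mathbf{If}[f,g,h](\vec x,x)=(f(\vec x),x)$ if $x>0$, $(g(\vec x),x)$ if $x=0$, $(h(\vec x),x)$ if $x<0$. Language syntax: values $v ::= ()\mid x\mid\mathtt{inl}\,v\mid\mathtt{inr}\,v\mid\langle v_1,v_2\rangle\mid\mathtt{fold}\,v$;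 patterns $p::=x\mid\langle p_1,p_2\rangle$; expressions $e::=v\mid\mathtt{let}\,p_1=\omega\,p_2\,\mathtt{in}\,e$; isos $\omega::=\{v_1\leftrightarrow e_1\mid\dots\mid v_n\leftrightarrow e_n\}\mid\mathtt{fix}\,g.\omega\mid g$; terms $t::=()\mid x\mid\mathtt{inl}\,t\mid\mathtt{inr}\,t\mid\langle t_1,t_2\rangle\mid\mathtt{fold}\,t\mid\omega\,t\mid\mathtt{let}\,p=t_1\,\mathtt{in}\,t_2$; $(x_1,\dots,x_n)=\langle x_1,\langle\dots,x_n\rangle\rangle$. Pattern matching $\sigma[v]=v'$ ($\sigma$ a finite map from variables to values): $\sigma[x]=e$ when $\sigma=\{x\mapsto e\}$; $\sigma[()]=()$; $\sigma[\mathtt{inl}\,e]=\mathtt{inl}\,e'$ if $\sigma[e]=e'$, similarly for $\mathtt{inr},\mathtt{fold}$; $\sigma[\langle e_1,e_2\rangle]=\langle e_1',e_2'\rangle$ if $\sigma_1[e_1]=e_1'$, $\sigma_2[e_2]=e_2'$ with disjoint supports and $\sigma=\sigma_1\cup\sigma_2$. $\sigma(t)$ is capture-avoiding replacement of variables by their images. Evaluation contexts $C ::= [\,]\mid\mathtt{inl}\,C\mid\mathtt{inr}\,C\mid\omega\,C\mid\mathtt{let}\,p=C\,\mathtt{in}\,t\mid\langle C,v\rangle\mid\langle v,C\rangle\mid\mathtt{fold}\,C\mid C\,t$. Reduction: $C[t_1]\to C[t_2]$ if $t_1\to t_2$; $\mathtt{let}\,p=v\,\mathtt{in}\,t\to\sigma(t)$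 if $\sigma[p]=v$; $\mathtt{fix}\,g.\omega\to\omega[g:=\mathtt{fix}\,g.\omega]$; $\{v_1\leftrightarrow e_1\mid\dots\mid v_n\leftrightarrow e_n\}\,v'\to\sigma(e_i)$ if $\sigma[v_i]=v'$; $\to^*$ is the reflexive transitive closure. Encoding of integers: $\mathrm{npos}=\mu X.\mathbb{1}\oplus X$, $Z=\mathbb{1}\oplus(\mathrm{npos}\oplus\mathrm{npos})$; $\underline{1}=\mathtt{fold}(\mathtt{inl}())$, $\underline{n+1}=\mathtt{fold}(\mathtt{inr}\,\underline{n})$ for $n\ge1$; $\overline{0}=\mathtt{inl}()$, $\overline{z}=\mathtt{inr}(\mathtt{inl}\,\underline{z})$ for $z>0$, $\overline{z}=\mathtt{inr}(\mathtt{inr}\,\underline{ -z})$ for $z<0$. $\mathrm{isos}(f)$ is defined by induction on the derivation of $f\in\mathrm{RPP}^k$: $\mathrm{isos}(\mathrm{Id})=\{x\leftrightarrow x\}$; $\mathrm{isos}(\mathcal{X})=\{(x,y)\leftrightarrow(y,x)\}$; $\mathrm{isos}(\mathrm{Sign})=\{\mathtt{inr}(\mathtt{inl}\,x)\leftrightarrow\mathtt{inr}(\mathtt{inr}\,x)\mid\mathtt{inr}(\mathtt{inr}\,x)\leftrightarrow\mathtt{inr}(\mathtt{inl}\,x)\mid\mathtt{inl}()\leftrightarrow\mathtt{inl}()\}$; $\mathrm{isos}(S)=\{\mathtt{inl}()\leftrightarrow\mathtt{inr}(\mathtt{inl}(\mathtt{fold}(\mathtt{inl}())))\mid\mathtt{inr}(\mathtt{inl}\,x)\leftrightarrow\mathtt{inr}(\mathtt{inl}(\mathtt{fold}(\mathtt{inr}\,x)))\mid\mathtt{inr}(\mathtt{inr}(\mathtt{fold}(\mathtt{inl}())))\leftrightarrow\mathtt{inl}()\mid\mathtt{inr}(\mathtt{inr}(\mathtt{fold}(\mathtt{inr}\,x)))\leftrightarrow\mathtt{inr}(\mathtt{inr}\,x)\}$;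 $\mathrm{isos}(P)$ is the same set of clauses with the two sides of each clause swapped. With $\omega_f=\mathrm{isos}(f)$ etc.: $\mathrm{isos}(f;g)=\{\vec x\leftrightarrow\mathtt{let}\,\vec y=\omega_f\,\vec x\,\mathtt{in}\,\mathtt{let}\,\vec z=\omega_g\,\vec y\,\mathtt{in}\,\vec z\}$; $\mathrm{isos}(f\parallel g)=\{(x_1,\dots,x_j,y_1,\dots,y_k)\leftrightarrow\mathtt{let}\,(x_1',\dots,x_j')=\omega_f(x_1,\dots,x_j)\,\mathtt{in}\,\mathtt{let}\,(y_1',\dots,y_k')=\omega_g(y_1,\dots,y_k)\,\mathtt{in}\,(x_1',\dots,x_j',y_1',\dots,y_k')\}$; for $f\in\mathrm{RPP}^k$, $\omega_{aux}=\mathtt{fix}\,g.\{(\vec x,\mathtt{fold}(\mathtt{inl}()))\leftrightarrow\mathtt{let}\,\vec y=\omega_f\,\vec x\,\mathtt{in}\,(\vec y,\mathtt{fold}(\mathtt{inl}()))\mid(\vec x,\mathtt{fold}(\mathtt{inr}\,n))\leftrightarrow\mathtt{let}\,\vec y=\omega_f\,\vec x\,\mathtt{in}\,\mathtt{let}\,(\vec z,n')=g\,(\vec y,n)\,\mathtt{in}\,(\vec z,\mathtt{fold}(\mathtt{inr}\,n'))\}$ and $\mathrm{isos}(\mathbf{It}[f])=\{(\vec x,\mathtt{inl}())\leftrightarrow(\vec x,\mathtt{inl}())\mid(\vec x,\mathtt{inr}(\mathtt{inl}\,z))\leftrightarrow\mathtt{let}\,(\vec y,z')=\omega_{aux}(\vec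 x,z)\,\mathtt{in}\,(\vec y,\mathtt{inr}(\mathtt{inl}\,z'))\mid(\vec x,\mathtt{inr}(\mathtt{inr}\,z))\leftrightarrow\mathtt{let}\,(\vec y,z')=\omega_{aux}(\vec x,z)\,\mathtt{in}\,(\vec y,\mathtt{inr}(\mathtt{inr}\,z'))\}$; $\mathrm{isos}(\mathbf{If}[f,g,h])=\{(\vec x,\mathtt{inr}(\mathtt{inl}\,z))\leftrightarrow\mathtt{let}\,\vec x'=\omega_f\,\vec x\,\mathtt{in}\,(\vec x',\mathtt{inr}(\mathtt{inl}\,z))\mid(\vec x,\mathtt{inl}())\leftrightarrow\mathtt{let}\,\vec x'=\omega_g\,\vec x\,\mathtt{in}\,(\vec x',\mathtt{inl}())\mid(\vec x,\mathtt{inr}(\mathtt{inr}\,z))\leftrightarrow\mathtt{let}\,\vec x'=\omega_h\,\vec x\,\mathtt{in}\,(\vec x',\mathtt{inr}(\mathtt{inr}\,z))\}$. In each case $\vec x,\vec y,\vec z,\vec x'$ are tuples of $k$ distinct fresh variables. -}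

module Defs where

open import Data.Nat using (ℕ; zero; suc; _+_; _*_; _≡ᵇ_)
open import Data.Integer using (ℤ; +_; -[1+_]; ∣_∣) renaming (suc to sucℤ; pred to predℤ; -_ to negℤ)
open import Data.Bool using (Bool; true; false; if_then_else_)
open import Data.Product using (_×_; _,_; proj₁)
open import Data.List using (List; []; _∷_; _++_; filter; map)
open import Data.List.Membership.Propositional using (_∈_)
open import Data.List.Relation.Binary.Disjoint.Propositional using (Disjoint)
open import Data.Vec as V using (Vec; []; _∷_; _∷ʳ_)
open import Relation.Nullary.Decidable using (¬?)
open import Data.Nat.Properties using (_≟_)
open import Relation.Binary.Construct.Closure.ReflexiveTransitive using (Star)

data RPP : ℕ → Set where
  S P Id Sign : RPP 1
  X           : RPP 2
  _⨾_         : ∀ {k} → RPP k → RPP k → RPP k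
  _∥_         : ∀ {k l} → RPP k → RPP l → RPP (k + l)
  It          : ∀ {k} → RPP k → RPP (suc k)
  If          : ∀ {k} → RPP k → RPP k → RPP k → RPP (suc k)

iter : ∀ {A : Set} → ℕ → (A → A) → A → A
iter zero    f a = a
iter (suc n) f a = f (iter n f a)

select : ∀ {A : Set} → ℤ → A → A → A → A
select (+ zero)    pos zer neg = zer
select (+ (suc _)) pos zer neg = pos
select -[1+ _ ]    pos zer neg = neg

⟦_⟧ : ∀ {k} → RPP k → Vec ℤ k → Vec ℤ k
⟦ S ⟧    (x ∷ []) = sucℤ x ∷ []
⟦ P ⟧    (x ∷ []) = predℤ x ∷ []
⟦ Id ⟧   v = v
⟦ Sign ⟧ (x ∷ []) = negℤ x ∷ []
⟦ X ⟧    (x ∷ y ∷ []) = y ∷ x ∷ []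
⟦ f ⨾ g ⟧ v = ⟦ g ⟧ (⟦ f ⟧ v)
⟦ _∥_ {k} f g ⟧ v = ⟦ f ⟧ (V.take k v) V.++ ⟦ g ⟧ (V.drop k v)
⟦ It f ⟧ v = iter ∣ V.last v ∣ ⟦ f ⟧ (V.init v) ∷ʳ V.last v
⟦ If f g h ⟧ v = select (V.last v) (⟦ f ⟧ (V.init v)) (⟦ g ⟧ (V.init v)) (⟦ h ⟧ (V.init v)) ∷ʳ V.last v

-- Term variables and iso variables are natural numbers (separate namespaces).
-- Values, expressions and terms are all represented in the single type Term
-- (values = terms built from unit, var, inl, inr, pair, fold; expressions
-- 'let p1 = ω p2 in e' = lett p1 (app ω p2) e).

data Pat : Set where
  pvar  : ℕ → Pat
  ppair : Pat → Pat → Pat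

mutual
  data Iso : Set where
    clauses : List (Term × Term) → Iso   -- { v1 ↔ e1 | ... | vn ↔ en }
    fix     : ℕ → Iso → Iso
    ivar    : ℕ → Iso

  data Term : Set where
    unit : Term
    var  : ℕ → Term
    inl inr fold : Term → Term
    pair : Term → Term → Term
    app  : Iso → Term → Term
    lett : Pat → Term → Term → Term

patTerm : Pat → Term
patTerm (pvar x) = var x
patTerm (ppair p q) = pair (patTerm p) (patTerm q)

data IsValue : Term → Set where
  v-unit : IsValue unit
  v-var  : ∀ {x} → IsValue (var x)
  v-inl  : ∀ {v} → IsValue v → IsValue (inl v)
  v-inr  : ∀ {v} → IsValue v → IsValue (inr v)
  v-fold : ∀ {v} → IsValue v → IsValue (fold v)
  v-pair : ∀ {v w} → IsValue v → IsValue w → IsValue (pair v w)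

Subst : Set
Subst = List (ℕ × Term)

dom : Subst → List ℕ
dom = map proj₁

data Match : Subst → Term → Term → Set where
  m-var  : ∀ {x e} → IsValue e → Match ((x , e) ∷ []) (var x) e
  m-unit : Match [] unit unit
  m-inl  : ∀ {σ e e'} → Match σ e e' → Match σ (inl e) (inl e')
  m-inr  : ∀ {σ e e'} → Match σ e e' → Match σ (inr e) (inr e')
  m-fold : ∀ {σ e e'} → Match σ e e' → Match σ (fold e) (fold e')
  m-pair : ∀ {σ₁ σ₂ e₁ e₁' e₂ e₂'} → Match σ₁ e₁ e₁' → Match σ₂ e₂ e₂' →
           Disjoint (dom σ₁) (dom σ₂) → Match (σ₁ ++ σ₂) (pair e₁ e₂) (pair e₁' e₂')

-- variables occurring in a value (the left-hand sides of iso clauses are values)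
valVars : Term → List ℕ
valVars unit = []
valVars (var x) = x ∷ []
valVars (inl t) = valVars t
valVars (inr t) = valVars t
valVars (fold t) = valVars t
valVars (pair t u) = valVars t ++ valVars u
valVars (app _ _) = []
valVars (lett _ _ _) = []

patVars : Pat → List ℕ
patVars p = valVars (patTerm p)

lookupS : Subst → ℕ → Term
lookupS [] x = var x
lookupS ((y , e) ∷ σ) x = if x ≡ᵇ y then e else lookupS σ x

removeS : List ℕ → Subst → Subst
removeS [] σ = σ
removeS (x ∷ xs) σ = removeS xs (filter (λ p → ¬? (proj₁ p ≟ x)) σ)

-- σ(t): replacement of free variables by their images, not entering binders
-- for the bound variables (capture-avoiding since images are closed values
-- in all reductions from closed terms).
mutual
  substT : Subst → Term → Term
  substT σ unit = unit
  substT σ (var x) = lookupS σ x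
  substT σ (inl t) = inl (substT σ t)
  substT σ (inr t) = inr (substT σ t)
  substT σ (fold t) = fold (substT σ t)
  substT σ (pair t u) = pair (substT σ t) (substT σ u)
  substT σ (app ω t) = app (substI σ ω) (substT σ t)
  substT σ (lett p t u) = lett p (substT σ t) (substT (removeS (patVars p) σ) u)

  substI : Subst → Iso → Iso
  substI σ (clauses cs) = clauses (substC σ cs)
  substI σ (fix g ω) = fix g (substI σ ω)
  substI σ (ivar g) = ivar g

  substC : Subst → List (Term × Term) → List (Term × Term)
  substC σ [] = []
  substC σ ((v , e) ∷ cs) = (v , substT (removeS (valVars v) σ) e) ∷ substC σ cs

-- ω[g := ω'] (iso-variable substitution; ω' closed)
mutual
  isubT : ℕ → Iso → Term → Term
  isubT g w unit = unit
  isubT g w (var x) = var x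
  isubT g w (inl t) = inl (isubT g w t)
  isubT g w (inr t) = inr (isubT g w t)
  isubT g w (fold t) = fold (isubT g w t)
  isubT g w (pair t u) = pair (isubT g w t) (isubT g w u)
  isubT g w (app ω t) = app (isubI g w ω) (isubT g w t)
  isubT g w (lett p t u) = lett p (isubT g w t) (isubT g w u)

  isubI : ℕ → Iso → Iso → Iso
  isubI g w (clauses cs) = clauses (isubC g w cs)
  isubI g w (fix h ω) = if g ≡ᵇ h then fix h ω else fix h (isubI g w ω)
  isubI g w (ivar h) = if g ≡ᵇ h then w else ivar h

  isubC : ℕ → Iso → List (Term × Term) → List (Term × Term)
  isubC g w [] = []
  isubC g w ((v , e) ∷ cs) = (v , isubT g w e) ∷ isubC g w cs

-- Reduction (closure under evaluation contexts built in as congruence rules)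

infix 4 _⟶_ _⟶*_

data _⟶_ : Term → Term → Set where
  c-inl   : ∀ {t t'} → t ⟶ t' → inl t ⟶ inl t'
  c-inr   : ∀ {t t'} → t ⟶ t' → inr t ⟶ inr t'
  c-fold  : ∀ {t t'} → t ⟶ t' → fold t ⟶ fold t'
  c-app   : ∀ {ω t t'} → t ⟶ t' → app ω t ⟶ app ω t'
  c-let   : ∀ {p t t' u} → t ⟶ t' → lett p t u ⟶ lett p t' u
  c-pairˡ : ∀ {t t' v} → IsValue v → t ⟶ t' → pair t v ⟶ pair t' v
  c-pairʳ : ∀ {t t' v} → IsValue v → t ⟶ t' → pair v t ⟶ pair v t'
  β-let   : ∀ {σ p v t} → IsValue v → Match σ (patTerm p) v →
            lett p v t ⟶ substT σ t
  β-fix   : ∀ {g ω t} → app (fix g ω) t ⟶ app (isubI g (fix g ω) ω) t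
  β-iso   : ∀ {σ cs vᵢ eᵢ v'} → IsValue v' → (vᵢ , eᵢ) ∈ cs → Match σ vᵢ v' →
            app (clauses cs) v' ⟶ substT σ eᵢ

_⟶*_ : Term → Term → Set
_⟶*_ = Star _⟶_

under : ℕ → Term          -- under n = underline (n+1)
under zero = fold (inl unit)
under (suc n) = fold (inr (under n))

enc : ℤ → Term
enc (+ zero) = inl unit
enc (+ (suc n)) = inr (inl (under n))
enc -[1+ n ] = inr (inr (under n))

-- Tuples (x1,...,xn) = ⟨x1,⟨...,xn⟩⟩  (length 0 never arises: RPP 0 is empty)

tupT : ∀ {n} → Vec Term n → Term
tupT [] = unit
tupT (t ∷ []) = t
tupT (t ∷ u ∷ ts) = pair t (tupT (u ∷ ts))

tupP : ∀ {n} → Vec ℕ n → Pat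
tupP [] = pvar 0
tupP (x ∷ []) = pvar x
tupP (x ∷ y ∷ xs) = ppair (pvar x) (tupP (y ∷ xs))

vs : ℕ → (k : ℕ) → Vec ℕ k
vs o zero = []
vs o (suc k) = o ∷ vs (suc o) k

vsT : ∀ {k} → Vec ℕ k → Vec Term k
vsT = V.map var

isos : ∀ {k} → RPP k → Iso
isos Id = clauses ((var 0 , var 0) ∷ [])
isos X = clauses ((pair (var 0) (var 1) , pair (var 1) (var 0)) ∷ [])
isos Sign = clauses
  ( (inr (inl (var 0)) , inr (inr (var 0)))
  ∷ (inr (inr (var 0)) , inr (inl (var 0)))
  ∷ (inl unit , inl unit) ∷ [])
isos S = clauses
  ( (inl unit , inr (inl (fold (inl unit))))
  ∷ (inr (inl (var 0)) , inr (inl (fold (inr (var 0)))))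
  ∷ (inr (inr (fold (inl unit))) , inl unit)
  ∷ (inr (inr (fold (inr (var 0)))) , inr (inr (var 0))) ∷ [])
isos P = clauses
  ( (inr (inl (fold (inl unit))) , inl unit)
  ∷ (inr (inl (fold (inr (var 0)))) , inr (inl (var 0)))
  ∷ (inl unit , inr (inr (fold (inl unit))))
  ∷ (inr (inr (var 0)) , inr (inr (fold (inr (var 0))))) ∷ [])
isos (_⨾_ {k} f g) =
  let xs = vs 0 k ; ys = vs k k ; zs = vs (2 * k) k in
  clauses ((tupT (vsT xs) ,
    lett (tupP ys) (app (isos f) (tupT (vsT xs)))
      (lett (tupP zs) (app (isos g) (tupT (vsT ys))) (tupT (vsT zs)))) ∷ [])
isos (_∥_ {j} {k} f g) =
  let xs = vs 0 j ; ys = vs j k ; xs' = vs (j + k) j ; ys' = vs (j + k + j) k in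
  clauses ((tupT (vsT (xs V.++ ys)) ,
    lett (tupP xs') (app (isos f) (tupT (vsT xs)))
      (lett (tupP ys') (app (isos g) (tupT (vsT ys))) (tupT (vsT (xs' V.++ ys'))))) ∷ [])
isos (It {k} f) =
  let xs = vs 0 k ; ys = vs k k ; zs = vs (2 * k) k
      n = 3 * k ; n' = suc (3 * k)
      ωf = isos f
      ωaux = fix 0 (clauses
        ( (tupT (vsT xs ∷ʳ fold (inl unit)) ,
            lett (tupP ys) (app ωf (tupT (vsT xs))) (tupT (vsT ys ∷ʳ fold (inl unit))))
        ∷ (tupT (vsT xs ∷ʳ fold (inr (var n))) ,
            lett (tupP ys) (app ωf (tupT (vsT xs)))
              (lett (tupP (zs ∷ʳ n')) (app (ivar 0) (tupT (vsT ys ∷ʳ var n)))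
                (tupT (vsT zs ∷ʳ fold (inr (var n')))))) ∷ []))
      z = 2 * k ; z' = suc (2 * k)
  in clauses
    ( (tupT (vsT xs ∷ʳ inl unit) , tupT (vsT xs ∷ʳ inl unit))
    ∷ (tupT (vsT xs ∷ʳ inr (inl (var z))) ,
        lett (tupP (ys ∷ʳ z')) (app ωaux (tupT (vsT xs ∷ʳ var z)))
          (tupT (vsT ys ∷ʳ inr (inl (var z')))))
    ∷ (tupT (vsT xs ∷ʳ inr (inr (var z))) ,
        lett (tupP (ys ∷ʳ z')) (app ωaux (tupT (vsT xs ∷ʳ var z)))
          (tupT (vsT ys ∷ʳ inr (inr (var z'))))) ∷ [])
isos (If {k} f g h) =
  let xs = vs 0 k ; xs' = vs k k ; z = 2 * k in
  clauses
    ( (tupT (vsT xs ∷ʳ inr (inl (var z))) ,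
        lett (tupP xs') (app (isos f) (tupT (vsT xs))) (tupT (vsT xs' ∷ʳ inr (inl (var z)))))
    ∷ (tupT (vsT xs ∷ʳ inl unit) ,
        lett (tupP xs') (app (isos g) (tupT (vsT xs))) (tupT (vsT xs' ∷ʳ inl unit)))
    ∷ (tupT (vsT xs ∷ʳ inr (inr (var z))) ,
        lett (tupP xs') (app (isos h) (tupT (vsT xs))) (tupT (vsT xs' ∷ʳ inr (inr (var z))))) ∷ [])

{-# OPTIONS --safe #-}
module Submission where

-- Matching the encoded input against the
-- left-hand side of a clause of isos f binds a block of fresh variables to the
-- encoded arguments.  Every iso produced by isos is closed (clause bodies only
-- mention variables of their own left-hand side, and the only iso variable is
-- bound by the fix of ω_aux), so this substitution leaves the sub-isos alone and
-- only fills in their arguments; each let then runs a sub-iso by the induction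
-- hypothesis and binds its encoded result to the next block of variables.  For
-- It f, ω_aux unfolds once per unit of the unary counter |x|, which is an inner
-- induction on that counter.

open import Defs
open import Data.Nat using (ℕ; zero; suc; _+_; _*_; _≡ᵇ_; _≤_; _<_; s≤s)
open import Data.Nat.Properties
  using ( _≟_; ≡ᵇ⇒≡; ≡⇒≡ᵇ; ≤-refl; ≤-reflexive; ≤-trans; <-irrefl; >⇒≢; n≤1+n; m≤m+n; m+n≤o⇒m≤o
        ; +-suc; +-comm; +-identityʳ; +-monoʳ-≤)
open import Data.Integer using (ℤ; +_; -[1+_]; ∣_∣)
open import Data.Bool using (true; false; if_then_else_)
open import Data.Product using (_×_; _,_; proj₁; proj₂; ∃)
open import Data.Sum using (_⊎_; inj₁; inj₂)
open import Data.Unit using (⊤; tt)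
open import Data.Empty using (⊥-elim)
open import Data.List using (List; []; _∷_; _++_)
import Data.List.Properties as LP
open import Data.List.Membership.Propositional using (_∈_; _∉_)
open import Data.List.Membership.Propositional.Properties using (∈-++⁺ˡ; ∈-++⁺ʳ; ∈-++⁻)
open import Data.List.Relation.Unary.Any using (here; there)
open import Data.List.Relation.Unary.All as ListAll using ([]; _∷_)
open import Data.List.Relation.Binary.Subset.Propositional using (_⊆_)
open import Data.List.Relation.Binary.Disjoint.Propositional using (Disjoint)
open import Data.Vec as V using (Vec; []; _∷_; _∷ʳ_; map; toList)
import Data.Vec.Properties as VP
open import Data.Vec.Relation.Unary.All using (All; []; _∷_; universal)
open import Data.Vec.Relation.Unary.All.Properties using (map⁺)
open import Relation.Binary.Construct.Closure.ReflexiveTransitive using (ε; _◅_; gmap)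
open import Relation.Binary.Construct.Closure.ReflexiveTransitive.Properties using (module StarReasoning)
open import Function using (_∘_)
open import Relation.Binary.PropositionalEquality
  using (_≡_; _≢_; refl; sym; trans; cong; cong₂; subst; subst₂; module ≡-Reasoning)
open import Relation.Nullary using (¬_; yes; no)

lookupS-here : ∀ x e σ → lookupS ((x , e) ∷ σ) x ≡ e
lookupS-here x e σ with x ≡ᵇ x | ≡⇒≡ᵇ x x refl
... | true | _ = refl

lookupS-there : ∀ {x y} e σ → x ≢ y → lookupS ((y , e) ∷ σ) x ≡ lookupS σ x
lookupS-there {x} {y} e σ x≢y with x ≡ᵇ y | ≡ᵇ⇒≡ x y
... | true  | x≡y = ⊥-elim (x≢y (x≡y tt))
... | false | _   = refl

lookupS-removeS-here : ∀ x σ → lookupS (removeS (x ∷ []) σ) x ≡ var x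
lookupS-removeS-here x []            = refl
lookupS-removeS-here x ((a , e) ∷ σ) with a ≡ᵇ x | ≡⇒≡ᵇ a x
... | true  | _   = lookupS-removeS-here x σ
... | false | a≢x = trans (lookupS-there e (removeS (x ∷ []) σ) (a≢x ∘ sym)) (lookupS-removeS-here x σ)

lookupS-removeS-there : ∀ {x y} σ → x ≢ y → lookupS (removeS (y ∷ []) σ) x ≡ lookupS σ x
lookupS-removeS-there []            x≢y = refl
lookupS-removeS-there {x} {y} ((a , e) ∷ σ) x≢y with a ≡ᵇ y | ≡ᵇ⇒≡ a y
... | true  | a≡y rewrite a≡y tt = trans (lookupS-removeS-there σ x≢y) (sym (lookupS-there e σ x≢y))
... | false | _   = cong (if x ≡ᵇ a then e else_) (lookupS-removeS-there σ x≢y)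

lookupS-removeS-var : ∀ {x} ys σ → lookupS σ x ≡ var x → lookupS (removeS ys σ) x ≡ var x
lookupS-removeS-var     []       σ σx≡x = σx≡x
lookupS-removeS-var {x} (y ∷ ys) σ σx≡x = lookupS-removeS-var ys (removeS (y ∷ []) σ) removed
  where
  removed : lookupS (removeS (y ∷ []) σ) x ≡ var x
  removed with x ≟ y
  ... | yes refl = lookupS-removeS-here x σ
  ... | no  x≢y  = trans (lookupS-removeS-there σ x≢y) σx≡x

lookupS-removeS-∈ : ∀ {x} ys σ → x ∈ ys → lookupS (removeS ys σ) x ≡ var x
lookupS-removeS-∈ (y ∷ ys) σ (here refl) = lookupS-removeS-var ys _ (lookupS-removeS-here y σ)
lookupS-removeS-∈ (y ∷ ys) σ (there x∈ys) = lookupS-removeS-∈ ys _ x∈ys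

lookupS-removeS-∉ : ∀ {x} ys σ → x ∉ ys → lookupS (removeS ys σ) x ≡ lookupS σ x
lookupS-removeS-∉ []       σ x∉ys = refl
lookupS-removeS-∉ (y ∷ ys) σ x∉ys =
  trans (lookupS-removeS-∉ ys _ (x∉ys ∘ there)) (lookupS-removeS-there σ (x∉ys ∘ here))

removeS-++ : ∀ xs ys σ → removeS (xs ++ ys) σ ≡ removeS ys (removeS xs σ)
removeS-++ []       ys σ = refl
removeS-++ (x ∷ xs) ys σ = removeS-++ xs ys (removeS (x ∷ []) σ)

under-value : ∀ n → IsValue (under n)
under-value zero    = v-fold (v-inl v-unit)
under-value (suc n) = v-fold (v-inr (under-value n))

enc-value : ∀ z → IsValue (enc z)
enc-value (+ zero)  = v-inl v-unit
enc-value (+ suc n) = v-inr (v-inl (under-value n))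
enc-value -[1+ n ]  = v-inr (v-inr (under-value n))

encs-value : ∀ {n} (zs : Vec ℤ n) → All IsValue (map enc zs)
encs-value zs = map⁺ (universal enc-value zs)

vars-value : ∀ {n} (xs : Vec ℕ n) → All IsValue (vsT xs)
vars-value xs = map⁺ (universal (λ _ → v-var) xs)

All-∷ʳ : ∀ {n} {P : Term → Set} {ts : Vec Term n} {t} → All P ts → P t → All P (ts ∷ʳ t)
All-∷ʳ []          pt = pt ∷ []
All-∷ʳ (pt′ ∷ pts) pt = pt′ ∷ All-∷ʳ pts pt

tupT-value : ∀ {n} {ts : Vec Term n} → All IsValue ts → IsValue (tupT ts)
tupT-value []                 = v-unit
tupT-value (vt ∷ [])          = vt
tupT-value (vt ∷ vts@(_ ∷ _)) = v-pair vt (tupT-value vts)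

substT-under : ∀ σ n → substT σ (under n) ≡ under n
substT-under σ zero    = refl
substT-under σ (suc n) = cong (fold ∘ inr) (substT-under σ n)

substT-enc : ∀ σ z → substT σ (enc z) ≡ enc z
substT-enc σ (+ zero)  = refl
substT-enc σ (+ suc n) = cong (inr ∘ inl) (substT-under σ n)
substT-enc σ -[1+ n ]  = cong (inr ∘ inr) (substT-under σ n)

substT-tupT : ∀ σ {n} (ts : Vec Term n) → substT σ (tupT ts) ≡ tupT (map (substT σ) ts)
substT-tupT σ []           = refl
substT-tupT σ (t ∷ [])     = refl
substT-tupT σ (t ∷ u ∷ ts) = cong (pair _) (substT-tupT σ (u ∷ ts))

map-substT-enc : ∀ σ {n} (zs : Vec ℤ n) → map (substT σ) (map enc zs) ≡ map enc zs
map-substT-enc σ zs = trans (sym (VP.map-∘ (substT σ) enc zs)) (VP.map-cong (substT-enc σ) zs)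

substT-encs : ∀ σ {n} (zs : Vec ℤ n) → substT σ (tupT (map enc zs)) ≡ tupT (map enc zs)
substT-encs σ zs = trans (substT-tupT σ (map enc zs)) (cong tupT (map-substT-enc σ zs))

substT-vars : ∀ σ {n} (xs : Vec ℕ n) → substT σ (tupT (vsT xs)) ≡ tupT (map (lookupS σ) xs)
substT-vars σ xs = trans (substT-tupT σ (vsT xs)) (cong tupT (sym (VP.map-∘ (substT σ) var xs)))

substT-vars-∷ʳ : ∀ σ {n} (xs : Vec ℕ n) t →
  substT σ (tupT (vsT xs ∷ʳ t)) ≡ tupT (map (lookupS σ) xs ∷ʳ substT σ t)
substT-vars-∷ʳ σ xs t = begin
  substT σ (tupT (vsT xs ∷ʳ t))
    ≡⟨ substT-tupT σ (vsT xs ∷ʳ t) ⟩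
  tupT (map (substT σ) (vsT xs ∷ʳ t))
    ≡⟨ cong tupT (VP.map-∷ʳ (substT σ) t (vsT xs)) ⟩
  tupT (map (substT σ) (vsT xs) ∷ʳ substT σ t)
    ≡⟨ cong (λ us → tupT (us ∷ʳ substT σ t)) (sym (VP.map-∘ (substT σ) var xs)) ⟩
  tupT (map (lookupS σ) xs ∷ʳ substT σ t) ∎
  where open ≡-Reasoning

isubT-value : ∀ {g W v} → IsValue v → isubT g W v ≡ v
isubT-value v-unit         = refl
isubT-value v-var          = refl
isubT-value (v-inl v)      = cong inl (isubT-value v)
isubT-value (v-inr v)      = cong inr (isubT-value v)
isubT-value (v-fold v)     = cong fold (isubT-value v)
isubT-value (v-pair v w)   = cong₂ pair (isubT-value v) (isubT-value w)

-- The last pattern of the clause of isos (It f) or isos (If f g h) that fires on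
-- enc c, with the magnitude of c bound to z, and the substitution of that match.
counterPat : ℕ → ℤ → Term
counterPat z (+ zero)  = inl unit
counterPat z (+ suc _) = inr (inl (var z))
counterPat z -[1+ _ ]  = inr (inr (var z))

counterSubst : ℕ → ℤ → Subst
counterSubst z (+ zero)  = []
counterSubst z (+ suc m) = (z , under m) ∷ []
counterSubst z -[1+ m ]  = (z , under m) ∷ []

counterPat-value : ∀ z c → IsValue (counterPat z c)
counterPat-value z (+ zero)  = v-inl v-unit
counterPat-value z (+ suc _) = v-inr (v-inl v-var)
counterPat-value z -[1+ _ ]  = v-inr (v-inr v-var)

counterPat-vars : ∀ z c → valVars (counterPat z c) ⊆ z ∷ []
counterPat-vars z (+ zero)  ()
counterPat-vars z (+ suc _) z∈ = z∈
counterPat-vars z -[1+ _ ]  z∈ = z∈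

match-counterPat : ∀ z c → Match (counterSubst z c) (counterPat z c) (enc c)
match-counterPat z (+ zero)  = m-inl m-unit
match-counterPat z (+ suc m) = m-inr (m-inl (m-var (under-value m)))
match-counterPat z -[1+ m ]  = m-inr (m-inr (m-var (under-value m)))

counterSubst-dom : ∀ z c {y} → y ∈ dom (counterSubst z c) → y ≡ z
counterSubst-dom z (+ suc _) (here y≡z) = y≡z
counterSubst-dom z -[1+ _ ]  (here y≡z) = y≡z

substT-counterPat : ∀ σ z c → lookupS σ z ≡ lookupS (counterSubst z c) z → substT σ (counterPat z c) ≡ enc c
substT-counterPat σ z (+ zero)  _    = refl
substT-counterPat σ z (+ suc m) σz≡ = cong (inr ∘ inl) (trans σz≡ (lookupS-here z (under m) []))
substT-counterPat σ z -[1+ m ]  σz≡ = cong (inr ∘ inr) (trans σz≡ (lookupS-here z (under m) []))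

∈-vs⁻ : ∀ {y} o k → y ∈ toList (vs o k) → o ≤ y × y < o + k
∈-vs⁻ {y} o (suc k) (here refl) = ≤-refl , subst (y <_) (sym (+-suc y k)) (s≤s (m≤m+n y k))
∈-vs⁻ {y} o (suc k) (there y∈)  with ∈-vs⁻ (suc o) k y∈
... | o<y , y<1+o+k = ≤-trans (n≤1+n o) o<y , subst (y <_) (sym (+-suc o k)) y<1+o+k

map-cong-∈ : ∀ {A B : Set} {f g : A → B} {n} (xs : Vec A n) →
  (∀ {x} → x ∈ toList xs → f x ≡ g x) → map f xs ≡ map g xs
map-cong-∈ []       f≗g = refl
map-cong-∈ (x ∷ xs) f≗g = cong₂ _∷_ (f≗g (here refl)) (map-cong-∈ xs (f≗g ∘ there))

bindFrom : ∀ {k} → ℕ → Vec Term k → Subst → Subst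
bindFrom o []       σ = σ
bindFrom o (t ∷ ts) σ = (o , t) ∷ bindFrom (suc o) ts σ

vs-++ : ∀ o a b → vs o a V.++ vs (o + a) b ≡ vs o (a + b)
vs-++ o zero    b = cong (λ o′ → vs o′ b) (+-identityʳ o)
vs-++ o (suc a) b = cong (o ∷_) (trans (cong (λ o′ → vs (suc o) a V.++ vs o′ b) (+-suc o a)) (vs-++ (suc o) a b))

bindFrom-++ : ∀ o {a b} (ts : Vec Term a) (us : Vec Term b) σ →
  bindFrom o (ts V.++ us) σ ≡ bindFrom o ts (bindFrom (o + a) us σ)
bindFrom-++ o []       us σ = cong (λ o′ → bindFrom o′ us σ) (sym (+-identityʳ o))
bindFrom-++ o (t ∷ ts) us σ =
  cong ((o , t) ∷_) (trans (bindFrom-++ (suc o) ts us σ)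
                           (cong (λ o′ → bindFrom (suc o) ts (bindFrom o′ us σ)) (sym (+-suc o _))))

lookupS-bindFrom : ∀ o {k} (ts : Vec Term k) σ → map (lookupS (bindFrom o ts σ)) (vs o k) ≡ ts
lookupS-bindFrom o []       σ = refl
lookupS-bindFrom o (t ∷ ts) σ = cong₂ _∷_ (lookupS-here o t (bindFrom (suc o) ts σ)) (begin
  map (lookupS ((o , t) ∷ bindFrom (suc o) ts σ)) (vs (suc o) _)
    ≡⟨ map-cong-∈ (vs (suc o) _)
                  (λ y∈ → lookupS-there t (bindFrom (suc o) ts σ) (>⇒≢ (proj₁ (∈-vs⁻ (suc o) _ y∈)))) ⟩
  map (lookupS (bindFrom (suc o) ts σ)) (vs (suc o) _)
    ≡⟨ lookupS-bindFrom (suc o) ts σ ⟩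
  ts ∎)
  where open ≡-Reasoning

lookupS-bindFrom-beyond : ∀ o {k} (ts : Vec Term k) σ {x} → o + k ≤ x →
  lookupS (bindFrom o ts σ) x ≡ lookupS σ x
lookupS-bindFrom-beyond o []       σ {x} o+0≤x = refl
lookupS-bindFrom-beyond o (t ∷ ts) σ {x} o+k≤x =
  trans (lookupS-there t (bindFrom (suc o) ts σ) (>⇒≢ (m+n≤o⇒m≤o (suc o) 1+o+k≤x)))
        (lookupS-bindFrom-beyond (suc o) ts σ 1+o+k≤x)
  where 1+o+k≤x = subst (_≤ x) (+-suc o _) o+k≤x

substT-bound-vars : ∀ o {k} (ts : Vec Term k) σ → substT (bindFrom o ts σ) (tupT (vsT (vs o k))) ≡ tupT ts
substT-bound-vars o {k} ts σ = trans (substT-vars (bindFrom o ts σ) (vs o k)) (cong tupT (lookupS-bindFrom o ts σ))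

substT-bound-vars-∷ʳ : ∀ o {k} (ts : Vec Term k) σ t →
  substT (bindFrom o ts σ) (tupT (vsT (vs o k) ∷ʳ t)) ≡ tupT (ts ∷ʳ substT (bindFrom o ts σ) t)
substT-bound-vars-∷ʳ o {k} ts σ t =
  trans (substT-vars-∷ʳ (bindFrom o ts σ) (vs o k) t)
        (cong (λ us → tupT (us ∷ʳ substT (bindFrom o ts σ) t)) (lookupS-bindFrom o ts σ))

shift-bound : ∀ o {k} {σ : Subst} → (∀ {y} → y ∈ dom σ → o + suc k ≤ y) →
  ∀ {y} → y ∈ dom σ → suc o + k ≤ y
shift-bound o {k} σ≥ {y} y∈ = subst (_≤ y) (+-suc o k) (σ≥ y∈)

bindFrom-dom-≥ : ∀ o {k} (ts : Vec Term k) σ → (∀ {y} → y ∈ dom σ → o + k ≤ y) →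
  ∀ {y} → y ∈ dom (bindFrom o ts σ) → o ≤ y
bindFrom-dom-≥ o []       σ σ≥ y∈          = m+n≤o⇒m≤o o (σ≥ y∈)
bindFrom-dom-≥ o (t ∷ ts) σ σ≥ (here refl) = ≤-refl
bindFrom-dom-≥ o (t ∷ ts) σ σ≥ (there y∈)  =
  ≤-trans (n≤1+n o) (bindFrom-dom-≥ (suc o) ts σ (shift-bound o σ≥) y∈)

bindFrom-fresh : ∀ o {k} (ts : Vec Term k) σ → (∀ {y} → y ∈ dom σ → suc o + k ≤ y) →
  Disjoint (o ∷ []) (dom (bindFrom (suc o) ts σ))
bindFrom-fresh o ts σ σ≥ (here refl , o∈) = <-irrefl refl (bindFrom-dom-≥ (suc o) ts σ σ≥ o∈)

match-vars : ∀ o {k} {ts : Vec Term k} → All IsValue ts →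
  Match (bindFrom o ts []) (tupT (vsT (vs o k))) (tupT ts)
match-vars o []                = m-unit
match-vars o (vt ∷ [])         = m-var vt
match-vars o {ts = _ ∷ ts} (vt ∷ vts@(_ ∷ _)) =
  m-pair (m-var vt) (match-vars (suc o) vts) (bindFrom-fresh o ts [] λ ())

match-vars-∷ʳ : ∀ o {k} {ts : Vec Term k} {σ p v} → All IsValue ts → Match σ p v →
  (∀ {y} → y ∈ dom σ → o + k ≤ y) →
  Match (bindFrom o ts σ) (tupT (vsT (vs o k) ∷ʳ p)) (tupT (ts ∷ʳ v))
match-vars-∷ʳ o []                m σ≥ = m
match-vars-∷ʳ o {σ = σ} (vt ∷ []) m σ≥ =
  m-pair (m-var vt) m (bindFrom-fresh o [] σ (shift-bound o σ≥))
match-vars-∷ʳ o {ts = _ ∷ ts} {σ} (vt ∷ vts@(_ ∷ _)) m σ≥ =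
  m-pair (m-var vt) (match-vars-∷ʳ (suc o) vts m (shift-bound o σ≥)) (bindFrom-fresh o ts σ (shift-bound o σ≥))

patTerm-tupP : ∀ {n} (xs : Vec ℕ (suc n)) → patTerm (tupP xs) ≡ tupT (vsT xs)
patTerm-tupP (x ∷ [])     = refl
patTerm-tupP (x ∷ y ∷ xs) = cong (pair (var x)) (patTerm-tupP (y ∷ xs))

lett-cong* : ∀ {p t t′ u} → t ⟶* t′ → lett p t u ⟶* lett p t′ u
lett-cong* {p} {u = u} = gmap (λ t → lett p t u) c-let

β-let-vars : ∀ o n {u} {rs : Vec Term (suc n)} → All IsValue rs →
  lett (tupP (vs o (suc n))) (tupT rs) u ⟶ substT (bindFrom o rs []) u
β-let-vars o n {rs = rs} vrs = β-let (tupT-value vrs) matches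
  where
  matches : Match (bindFrom o rs []) (patTerm (tupP (vs o (suc n)))) (tupT rs)
  matches = subst (λ p → Match (bindFrom o rs []) p (tupT rs)) (sym (patTerm-tupP (vs o (suc n)))) (match-vars o vrs)

β-let-vars-∷ʳ : ∀ o n q {u} {rs : Vec Term n} {r} → All IsValue rs → IsValue r → o + n ≤ q →
  lett (tupP (vs o n ∷ʳ q)) (tupT (rs ∷ʳ r)) u ⟶ substT (bindFrom o rs ((q , r) ∷ [])) u
β-let-vars-∷ʳ o n q {rs = rs} {r} vrs vr o+n≤q = β-let (tupT-value (All-∷ʳ vrs vr)) matches
  where
  pattern-shape : patTerm (tupP (vs o n ∷ʳ q)) ≡ tupT (vsT (vs o n) ∷ʳ var q)
  pattern-shape = trans (patTerm-tupP (vs o n ∷ʳ q)) (cong tupT (VP.map-∷ʳ var q (vs o n)))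
  matches : Match (bindFrom o rs ((q , r) ∷ [])) (patTerm (tupP (vs o n ∷ʳ q))) (tupT (rs ∷ʳ r))
  matches = subst (λ p → Match (bindFrom o rs ((q , r) ∷ [])) p (tupT (rs ∷ʳ r))) (sym pattern-shape)
                  (match-vars-∷ʳ o vrs (m-var vr) λ { (here refl) → o+n≤q })

-- Closedness of the isos

SubstInvariant : Iso → Set
SubstInvariant ω = ∀ σ → substI σ ω ≡ ω

ClosedIso : Iso → Set
ClosedIso ω = SubstInvariant ω × (∀ W → isubI 0 W ω ≡ ω)

Scoped : (Iso → Set) → List ℕ → Term → Set
Scoped Q xs unit         = ⊤
Scoped Q xs (var x)      = x ∈ xs
Scoped Q xs (inl t)      = Scoped Q xs t
Scoped Q xs (inr t)      = Scoped Q xs t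
Scoped Q xs (fold t)     = Scoped Q xs t
Scoped Q xs (pair t u)   = Scoped Q xs t × Scoped Q xs u
Scoped Q xs (app ω t)    = Q ω × Scoped Q xs t
Scoped Q xs (lett p t u) = Scoped Q xs t × Scoped Q (patVars p ++ xs) u

module _ {Q : Iso → Set} (invariant : ∀ {ω} → Q ω → SubstInvariant ω) where

  substT-scoped : ∀ {xs} t σ → Scoped Q xs t → (∀ {x} → x ∈ xs → lookupS σ x ≡ var x) → substT σ t ≡ t
  substT-scoped unit         σ sc         fixes = refl
  substT-scoped (var x)      σ x∈xs       fixes = fixes x∈xs
  substT-scoped (inl t)      σ sc         fixes = cong inl (substT-scoped t σ sc fixes)
  substT-scoped (inr t)      σ sc         fixes = cong inr (substT-scoped t σ sc fixes)
  substT-scoped (fold t)     σ sc         fixes = cong fold (substT-scoped t σ sc fixes)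
  substT-scoped (pair t u)   σ (sc , sc′) fixes =
    cong₂ pair (substT-scoped t σ sc fixes) (substT-scoped u σ sc′ fixes)
  substT-scoped (app ω t)    σ (pω , sc)  fixes = cong₂ app (invariant pω σ) (substT-scoped t σ sc fixes)
  substT-scoped {xs} (lett p t u) σ (sc , sc′) fixes =
    cong₂ (lett p) (substT-scoped t σ sc fixes) (substT-scoped u (removeS (patVars p) σ) sc′ fixes′)
    where
    fixes′ : ∀ {x} → x ∈ patVars p ++ xs → lookupS (removeS (patVars p) σ) x ≡ var x
    fixes′ x∈ with ∈-++⁻ (patVars p) x∈
    ... | inj₁ x∈p  = lookupS-removeS-∈ (patVars p) σ x∈p
    ... | inj₂ x∈xs = lookupS-removeS-var (patVars p) σ (fixes x∈xs)

isubT-scoped : ∀ {xs} t W → Scoped ClosedIso xs t → isubT 0 W t ≡ t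
isubT-scoped unit         W sc         = refl
isubT-scoped (var x)      W sc         = refl
isubT-scoped (inl t)      W sc         = cong inl (isubT-scoped t W sc)
isubT-scoped (inr t)      W sc         = cong inr (isubT-scoped t W sc)
isubT-scoped (fold t)     W sc         = cong fold (isubT-scoped t W sc)
isubT-scoped (pair t u)   W (sc , sc′) = cong₂ pair (isubT-scoped t W sc) (isubT-scoped u W sc′)
isubT-scoped (app ω t)    W (cω , sc)  = cong₂ app (proj₂ cω W) (isubT-scoped t W sc)
isubT-scoped (lett p t u) W (sc , sc′) = cong₂ (lett p) (isubT-scoped t W sc) (isubT-scoped u W sc′)

value-scoped : ∀ {Q ys v} → IsValue v → valVars v ⊆ ys → Scoped Q ys v
value-scoped v-unit       ⊆ys = tt
value-scoped v-var        ⊆ys = ⊆ys (here refl)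
value-scoped (v-inl v)    ⊆ys = value-scoped v ⊆ys
value-scoped (v-inr v)    ⊆ys = value-scoped v ⊆ys
value-scoped (v-fold v)   ⊆ys = value-scoped v ⊆ys
value-scoped (v-pair {v = t} v w) ⊆ys =
  value-scoped v (⊆ys ∘ ∈-++⁺ˡ) , value-scoped w (⊆ys ∘ ∈-++⁺ʳ (valVars t))

ScopedClauses : (Iso → Set) → List (Term × Term) → Set
ScopedClauses Q = ListAll.All (λ c → Scoped Q (valVars (proj₁ c)) (proj₂ c))

clauses-invariant : ∀ {Q cs} → (∀ {ω} → Q ω → SubstInvariant ω) → ScopedClauses Q cs → SubstInvariant (clauses cs)
clauses-invariant invariant scs σ = cong clauses (substC-scoped scs)
  where
  substC-scoped : ∀ {cs} → ScopedClauses _ cs → substC σ cs ≡ cs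
  substC-scoped []                      = refl
  substC-scoped {(v , e) ∷ _} (sc ∷ scs) =
    cong₂ _∷_ (cong (v ,_) (substT-scoped invariant e _ sc (lookupS-removeS-∈ (valVars v) σ)))
              (substC-scoped scs)

clauses-closed : ∀ {cs} → ScopedClauses ClosedIso cs → ClosedIso (clauses cs)
clauses-closed scs = clauses-invariant proj₁ scs , λ W → cong clauses (isubC-scoped W scs)
  where
  isubC-scoped : ∀ W {cs} → ScopedClauses ClosedIso cs → isubC 0 W cs ≡ cs
  isubC-scoped W []                      = refl
  isubC-scoped W {(v , e) ∷ _} (sc ∷ scs) = cong₂ _∷_ (cong (v ,_) (isubT-scoped e W sc)) (isubC-scoped W scs)

substT-removeS : ∀ {ys} t σ → Scoped ClosedIso ys t → substT (removeS ys σ) t ≡ t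
substT-removeS {ys} t σ sc = substT-scoped proj₁ t (removeS ys σ) sc (lookupS-removeS-∈ ys σ)

substT-lett-app : ∀ {ω σ p} a u {a′ u′} → ClosedIso ω →
  substT σ a ≡ a′ → substT (removeS (patVars p) σ) u ≡ u′ →
  substT σ (lett p (app ω a) u) ≡ lett p (app ω a′) u′
substT-lett-app {σ = σ} {p} a u cω refl refl =
  cong (λ ω → lett p (app ω (substT σ a)) (substT (removeS (patVars p) σ) u)) (proj₁ cω σ)

valVars-vars : ∀ {n} (xs : Vec ℕ n) → valVars (tupT (vsT xs)) ≡ toList xs
valVars-vars []           = refl
valVars-vars (x ∷ [])     = refl
valVars-vars (x ∷ y ∷ xs) = cong (x ∷_) (valVars-vars (y ∷ xs))

valVars-∷ʳ : ∀ {n} (ts : Vec Term n) t → valVars (tupT (ts ∷ʳ t)) ≡ valVars (tupT ts) ++ valVars t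
valVars-∷ʳ []           t = refl
valVars-∷ʳ (u ∷ [])     t = refl
valVars-∷ʳ (u ∷ v ∷ ts) t =
  trans (cong (valVars u ++_) (valVars-∷ʳ (v ∷ ts) t)) (sym (LP.++-assoc (valVars u) _ (valVars t)))

toList⊆tupP : ∀ {n} (xs : Vec ℕ n) → toList xs ⊆ patVars (tupP xs)
toList⊆tupP (x ∷ [])     x∈            = x∈
toList⊆tupP (x ∷ y ∷ xs) (here refl)   = here refl
toList⊆tupP (x ∷ y ∷ xs) (there x∈)    = there (toList⊆tupP (y ∷ xs) x∈)

patVars-tupP : ∀ {n} (xs : Vec ℕ (suc n)) → patVars (tupP xs) ≡ toList xs
patVars-tupP xs = trans (cong valVars (patTerm-tupP xs)) (valVars-vars xs)

∉-tupP-vs : ∀ {y} o n → y < o ⊎ o + suc n ≤ y → y ∉ patVars (tupP (vs o (suc n)))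
∉-tupP-vs o n outside y∈ with ∈-vs⁻ o (suc n) (subst (_ ∈_) (patVars-tupP (vs o (suc n))) y∈) | outside
... | o≤y , _   | inj₁ y<o     = <-irrefl refl (≤-trans y<o o≤y)
... | _ , y<o+n | inj₂ o+n≤y   = <-irrefl refl (≤-trans y<o+n o+n≤y)

lookupS-removeS-tupP : ∀ σ {n} (xs : Vec ℕ n) → map (lookupS (removeS (patVars (tupP xs)) σ)) xs ≡ vsT xs
lookupS-removeS-tupP σ xs = map-cong-∈ xs (lookupS-removeS-∈ _ σ ∘ toList⊆tupP xs)

tupP-init : ∀ {n} (xs : Vec ℕ n) q → toList xs ⊆ patVars (tupP (xs ∷ʳ q))
tupP-init xs q = toList⊆tupP (xs ∷ʳ q) ∘ subst (_ ∈_) (sym (VP.toList-∷ʳ q xs)) ∘ ∈-++⁺ˡ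

tupP-last : ∀ {n} (xs : Vec ℕ n) q → q ∈ patVars (tupP (xs ∷ʳ q))
tupP-last xs q = toList⊆tupP (xs ∷ʳ q) (subst (_ ∈_) (sym (VP.toList-∷ʳ q xs)) (∈-++⁺ʳ (toList xs) (here refl)))

valVars-vars-∷ʳ : ∀ {n} (xs : Vec ℕ n) p → valVars (tupT (vsT xs ∷ʳ p)) ≡ toList xs ++ valVars p
valVars-vars-∷ʳ xs p = trans (valVars-∷ʳ (vsT xs) p) (cong (_++ valVars p) (valVars-vars xs))

lhs-init : ∀ {n} (xs : Vec ℕ n) p → toList xs ⊆ valVars (tupT (vsT xs ∷ʳ p))
lhs-init xs p = subst (_ ∈_) (sym (valVars-vars-∷ʳ xs p)) ∘ ∈-++⁺ˡ

lhs-last : ∀ {n} (xs : Vec ℕ n) p → valVars p ⊆ valVars (tupT (vsT xs ∷ʳ p))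
lhs-last xs p = subst (_ ∈_) (sym (valVars-vars-∷ʳ xs p)) ∘ ∈-++⁺ʳ (toList xs)

vars-scoped : ∀ {Q ys n} (xs : Vec ℕ n) → toList xs ⊆ ys → Scoped Q ys (tupT (vsT xs))
vars-scoped xs ⊆ys = value-scoped (tupT-value (vars-value xs)) (⊆ys ∘ subst (_ ∈_) (valVars-vars xs))

vars-∷ʳ-scoped : ∀ {Q ys n} (xs : Vec ℕ n) {p} → IsValue p → toList xs ⊆ ys → valVars p ⊆ ys →
  Scoped Q ys (tupT (vsT xs ∷ʳ p))
vars-∷ʳ-scoped {ys = ys} xs {p} vp xs⊆ p⊆ = value-scoped (tupT-value (All-∷ʳ (vars-value xs) vp)) ⊆ys
  where
  ⊆ys : valVars (tupT (vsT xs ∷ʳ p)) ⊆ ys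
  ⊆ys x∈ with ∈-++⁻ (toList xs) (subst (_ ∈_) (valVars-vars-∷ʳ xs p) x∈)
  ... | inj₁ x∈xs = xs⊆ x∈xs
  ... | inj₂ x∈p  = p⊆ x∈p

-- The clauses of ω_aux in isos (It f), with the recursive call g replaced by ω;
-- ωaux f is definitionally the iso used there.
auxClauses : ∀ {k} → RPP k → Iso → List (Term × Term)
auxClauses {k} f ω =
  let xs = vs 0 k ; ys = vs k k ; zs = vs (2 * k) k ; n = 3 * k ; n′ = suc (3 * k) in
    (tupT (vsT xs ∷ʳ fold (inl unit)) ,
       lett (tupP ys) (app (isos f) (tupT (vsT xs))) (tupT (vsT ys ∷ʳ fold (inl unit))))
  ∷ (tupT (vsT xs ∷ʳ fold (inr (var n))) ,
       lett (tupP ys) (app (isos f) (tupT (vsT xs)))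
         (lett (tupP (zs ∷ʳ n′)) (app ω (tupT (vsT ys ∷ʳ var n))) (tupT (vsT zs ∷ʳ fold (inr (var n′))))))
  ∷ []

ωaux : ∀ {k} → RPP k → Iso
ωaux f = fix 0 (clauses (auxClauses f (ivar 0)))

-- The recursive call ivar 0 is invariant under substitution but not under
-- unfolding of the fix, hence only SubstInvariant here.
aux-scoped : ∀ {k} (f : RPP k) → SubstInvariant (isos f) → ScopedClauses SubstInvariant (auxClauses f (ivar 0))
aux-scoped {k} f invariant =
    ((invariant , vars-scoped xs (lhs-init xs _)) ,
     vars-∷ʳ-scoped ys (v-fold (v-inl v-unit)) (∈-++⁺ˡ ∘ toList⊆tupP ys) (λ ()))
  ∷ ((invariant , vars-scoped xs (lhs-init xs _)) ,
     ((λ σ → refl) , vars-∷ʳ-scoped ys v-var (∈-++⁺ˡ ∘ toList⊆tupP ys) (∈-++⁺ʳ _ ∘ lhs-last xs _)) ,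
     vars-∷ʳ-scoped zs (v-fold (v-inr v-var)) (∈-++⁺ˡ ∘ tupP-init zs n′)
                    λ { (here refl) → ∈-++⁺ˡ (tupP-last zs n′) })
  ∷ []
  where
  xs ys zs : Vec ℕ k
  xs = vs 0 k
  ys = vs k k
  zs = vs (2 * k) k
  n′ : ℕ
  n′ = suc (3 * k)

ωaux-closed : ∀ {k} (f : RPP k) → SubstInvariant (isos f) → ClosedIso (ωaux f)
ωaux-closed f invariant =
  (λ σ → cong (fix 0) (clauses-invariant (λ inv → inv) (aux-scoped f invariant) σ)) , (λ W → refl)

isos-closed : ∀ {k} (f : RPP k) → ClosedIso (isos f)
isos-closed S    = clauses-closed (tt ∷ here refl ∷ tt ∷ here refl ∷ [])
isos-closed P    = clauses-closed (tt ∷ here refl ∷ tt ∷ here refl ∷ [])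
isos-closed Id   = clauses-closed (here refl ∷ [])
isos-closed Sign = clauses-closed (here refl ∷ here refl ∷ tt ∷ [])
isos-closed X    = clauses-closed ((there (here refl) , here refl) ∷ [])
isos-closed (_⨾_ {k} f g) = clauses-closed
  (((isos-closed f , vars-scoped xs (subst (_ ∈_) (sym (valVars-vars xs)))) ,
    (isos-closed g , vars-scoped ys (∈-++⁺ˡ ∘ toList⊆tupP ys)) ,
    vars-scoped zs (∈-++⁺ˡ ∘ toList⊆tupP zs)) ∷ [])
  where
  xs ys zs : Vec ℕ k
  xs = vs 0 k
  ys = vs k k
  zs = vs (2 * k) k
isos-closed (_∥_ {j} {k} f g) = clauses-closed
  (((isos-closed f , vars-scoped xs (lhs ∘ ∈-++⁺ˡ)) ,
    (isos-closed g , vars-scoped ys (∈-++⁺ʳ _ ∘ lhs ∘ ∈-++⁺ʳ (toList xs))) ,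
    vars-scoped (xs′ V.++ ys′) out) ∷ [])
  where
  xs xs′ : Vec ℕ j
  xs  = vs 0 j
  xs′ = vs (j + k) j
  ys ys′ : Vec ℕ k
  ys  = vs j k
  ys′ = vs (j + k + j) k
  lhs : toList xs ++ toList ys ⊆ valVars (tupT (vsT (xs V.++ ys)))
  lhs = subst (_ ∈_) (sym (trans (valVars-vars (xs V.++ ys)) (VP.toList-++ xs ys)))
  out : toList (xs′ V.++ ys′) ⊆ patVars (tupP ys′) ++ patVars (tupP xs′) ++ valVars (tupT (vsT (xs V.++ ys)))
  out x∈ with ∈-++⁻ (toList xs′) (subst (_ ∈_) (VP.toList-++ xs′ ys′) x∈)
  ... | inj₁ x∈xs′ = ∈-++⁺ʳ (patVars (tupP ys′)) (∈-++⁺ˡ (toList⊆tupP xs′ x∈xs′))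
  ... | inj₂ x∈ys′ = ∈-++⁺ˡ (toList⊆tupP ys′ x∈ys′)
isos-closed (It {k} f) = clauses-closed
  ( vars-∷ʳ-scoped xs (v-inl v-unit) (lhs-init xs _) (λ ())
  ∷ counting (+ 1) (here refl) ∷ counting -[1+ 0 ] (here refl) ∷ [])
  where
  xs ys : Vec ℕ k
  xs = vs 0 k
  ys = vs k k
  z z′ : ℕ
  z  = 2 * k
  z′ = suc (2 * k)
  counting : ∀ c → z ∈ valVars (counterPat z c) →
    Scoped ClosedIso (valVars (tupT (vsT xs ∷ʳ counterPat z c)))
      (lett (tupP (ys ∷ʳ z′)) (app (ωaux f) (tupT (vsT xs ∷ʳ var z))) (tupT (vsT ys ∷ʳ counterPat z′ c)))
  counting c z∈ =
    (ωaux-closed f (proj₁ (isos-closed f)) ,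
     vars-∷ʳ-scoped xs v-var (lhs-init xs _) λ { (here refl) → lhs-last xs _ z∈ }) ,
    vars-∷ʳ-scoped ys (counterPat-value z′ c) (∈-++⁺ˡ ∘ tupP-init ys z′) (bound ∘ counterPat-vars z′ c)
    where
    bound : z′ ∷ [] ⊆ patVars (tupP (ys ∷ʳ z′)) ++ valVars (tupT (vsT xs ∷ʳ counterPat z c))
    bound (here refl) = ∈-++⁺ˡ (tupP-last ys z′)
isos-closed (If {k} f g h) = clauses-closed
  (branch (isos-closed f) (v-inr (v-inl v-var)) ∷ branch (isos-closed g) (v-inl v-unit) ∷
   branch (isos-closed h) (v-inr (v-inr v-var)) ∷ [])
  where
  xs xs′ : Vec ℕ k
  xs  = vs 0 k
  xs′ = vs k k
  branch : ∀ {ω p} → ClosedIso ω → IsValue p →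
    Scoped ClosedIso (valVars (tupT (vsT xs ∷ʳ p))) (lett (tupP xs′) (app ω (tupT (vsT xs))) (tupT (vsT xs′ ∷ʳ p)))
  branch cω vp = (cω , vars-scoped xs (lhs-init xs _)) ,
                 vars-∷ʳ-scoped xs′ vp (∈-++⁺ˡ ∘ toList⊆tupP xs′) (∈-++⁺ʳ _ ∘ lhs-last xs _)

Simulates : ∀ {k} → RPP k → Set
Simulates {k} f = ∀ (ns : Vec ℤ k) → app (isos f) (tupT (map enc ns)) ⟶* tupT (map enc (⟦ f ⟧ ns))

clausesOf : Iso → List (Term × Term)
clausesOf (clauses cs) = cs
clausesOf _            = []

simulates-S : Simulates S
simulates-S (+ zero ∷ [])        = β-iso (v-inl v-unit) (here refl) (m-inl m-unit) ◅ ε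
simulates-S (+ suc n ∷ [])       =
  β-iso (enc-value (+ suc n)) (there (here refl)) (m-inr (m-inl (m-var (under-value n)))) ◅ ε
simulates-S (-[1+ zero ] ∷ [])   =
  β-iso (enc-value -[1+ 0 ]) (there (there (here refl))) (m-inr (m-inr (m-fold (m-inl m-unit)))) ◅ ε
simulates-S (-[1+ suc n ] ∷ [])  =
  β-iso (enc-value -[1+ suc n ]) (there (there (there (here refl))))
        (m-inr (m-inr (m-fold (m-inr (m-var (under-value n)))))) ◅ ε

simulates-P : Simulates P
simulates-P (+ zero ∷ [])        = β-iso (v-inl v-unit) (there (there (here refl))) (m-inl m-unit) ◅ ε
simulates-P (+ suc zero ∷ [])    =
  β-iso (enc-value (+ 1)) (here refl) (m-inr (m-inl (m-fold (m-inl m-unit)))) ◅ ε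
simulates-P (+ suc (suc n) ∷ []) =
  β-iso (enc-value (+ suc (suc n))) (there (here refl)) (m-inr (m-inl (m-fold (m-inr (m-var (under-value n)))))) ◅ ε
simulates-P (-[1+ n ] ∷ [])      =
  β-iso (enc-value -[1+ n ]) (there (there (there (here refl)))) (m-inr (m-inr (m-var (under-value n)))) ◅ ε

simulates-Id : Simulates Id
simulates-Id (z ∷ []) = β-iso (enc-value z) (here refl) (m-var (enc-value z)) ◅ ε

simulates-Sign : Simulates Sign
simulates-Sign (+ zero ∷ [])  = β-iso (v-inl v-unit) (there (there (here refl))) (m-inl m-unit) ◅ ε
simulates-Sign (+ suc n ∷ []) =
  β-iso (enc-value (+ suc n)) (here refl) (m-inr (m-inl (m-var (under-value n)))) ◅ ε
simulates-Sign (-[1+ n ] ∷ []) =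
  β-iso (enc-value -[1+ n ]) (there (here refl)) (m-inr (m-inr (m-var (under-value n)))) ◅ ε

simulates-X : Simulates X
simulates-X (y ∷ z ∷ []) =
  β-iso (v-pair (enc-value y) (enc-value z)) (here refl)
        (m-pair (m-var (enc-value y)) (m-var (enc-value z)) λ { (here refl , here ()) }) ◅ ε

simulates-⨾ : ∀ {k} (f g : RPP (suc k)) → Simulates f → Simulates g → Simulates (f ⨾ g)
simulates-⨾ {k} f g sim-f sim-g ns = begin
  app (isos (f ⨾ g)) (tupT E)
    ⟶⟨ β-iso (tupT-value (encs-value ns)) (here refl) (match-vars 0 (encs-value ns)) ⟩
  substT (bindFrom 0 E []) (lett (tupP ys) (app (isos f) (tupT (vsT xs))) rest)
    ≡⟨ substT-lett-app (tupT (vsT xs)) rest (isos-closed f) (substT-bound-vars 0 E []) (substT-removeS rest σ rest-scoped) ⟩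
  lett (tupP ys) (app (isos f) (tupT E)) rest
    ⟶*⟨ lett-cong* (sim-f ns) ⟩
  lett (tupP ys) (tupT M) rest
    ⟶⟨ β-let-vars K k (encs-value _) ⟩
  substT (bindFrom K M []) rest
    ≡⟨ substT-lett-app (tupT (vsT ys)) (tupT (vsT zs)) (isos-closed g) (substT-bound-vars K M [])
                       (substT-removeS (tupT (vsT zs)) σ′ (vars-scoped zs (toList⊆tupP zs))) ⟩
  lett (tupP zs) (app (isos g) (tupT M)) (tupT (vsT zs))
    ⟶*⟨ lett-cong* (sim-g (⟦ f ⟧ ns)) ⟩
  lett (tupP zs) (tupT N) (tupT (vsT zs))
    ⟶⟨ β-let-vars (2 * K) k (encs-value _) ⟩
  substT (bindFrom (2 * K) N []) (tupT (vsT zs))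
    ≡⟨ substT-bound-vars (2 * K) N [] ⟩
  tupT N ∎
  where
  open StarReasoning _⟶_
  K : ℕ
  K = suc k
  xs ys zs : Vec ℕ K
  xs = vs 0 K
  ys = vs K K
  zs = vs (2 * K) K
  E M N : Vec Term K
  E = map enc ns
  M = map enc (⟦ f ⟧ ns)
  N = map enc (⟦ g ⟧ (⟦ f ⟧ ns))
  σ σ′ : Subst
  σ  = bindFrom 0 E []
  σ′ = bindFrom K M []
  rest : Term
  rest = lett (tupP zs) (app (isos g) (tupT (vsT ys))) (tupT (vsT zs))
  rest-scoped : Scoped ClosedIso (patVars (tupP ys)) rest
  rest-scoped = (isos-closed g , vars-scoped ys (toList⊆tupP ys)) , vars-scoped zs (∈-++⁺ˡ ∘ toList⊆tupP zs)

simulates-∥ : ∀ {j k} (f : RPP (suc j)) (g : RPP (suc k)) → Simulates f → Simulates g → Simulates (f ∥ g)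
simulates-∥ {j} {k} f g sim-f sim-g ns = begin
  app (isos (f ∥ g)) (tupT (map enc ns))
    ≡⟨ cong (app (isos (f ∥ g)) ∘ tupT) split-input ⟩
  app (isos (f ∥ g)) (tupT (EA V.++ EB))
    ⟶⟨ β-iso (tupT-value (subst (All IsValue) (VP.map-++ enc as bs) (encs-value (as V.++ bs)))) (here refl) matches ⟩
  substT σ (lett (tupP xs′) (app (isos f) (tupT (vsT xs))) rest)
    ≡⟨ substT-lett-app (tupT (vsT xs)) rest (isos-closed f) (substT-bound-vars 0 EA (bindFrom J EB [])) enter-g ⟩
  lett (tupP xs′) (app (isos f) (tupT EA)) rest′
    ⟶*⟨ lett-cong* (sim-f as) ⟩
  lett (tupP xs′) (tupT MA) rest′
    ⟶⟨ β-let-vars (J + K) j (encs-value _) ⟩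
  substT (bindFrom (J + K) MA []) rest′
    ≡⟨ substT-lett-app (tupT EB) (tupT (vsT (xs′ V.++ ys′))) (isos-closed g) (substT-encs _ bs) leave-f ⟩
  lett (tupP ys′) (app (isos g) (tupT EB)) (tupT (MA V.++ vsT ys′))
    ⟶*⟨ lett-cong* (sim-g bs) ⟩
  lett (tupP ys′) (tupT MB) (tupT (MA V.++ vsT ys′))
    ⟶⟨ β-let-vars (J + K + J) k (encs-value _) ⟩
  substT (bindFrom (J + K + J) MB []) (tupT (MA V.++ vsT ys′))
    ≡⟨ leave-g ⟩
  tupT (map enc (⟦ f ⟧ as V.++ ⟦ g ⟧ bs)) ∎
  where
  open StarReasoning _⟶_
  J K : ℕ
  J = suc j
  K = suc k
  as : Vec ℤ J
  as = V.take J ns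
  bs : Vec ℤ K
  bs = V.drop J ns
  EA MA : Vec Term J
  EA = map enc as
  MA = map enc (⟦ f ⟧ as)
  EB MB : Vec Term K
  EB = map enc bs
  MB = map enc (⟦ g ⟧ bs)
  xs xs′ : Vec ℕ J
  xs  = vs 0 J
  xs′ = vs (J + K) J
  ys ys′ : Vec ℕ K
  ys  = vs J K
  ys′ = vs (J + K + J) K
  σ : Subst
  σ = bindFrom 0 EA (bindFrom J EB [])
  rest rest′ : Term
  rest  = lett (tupP ys′) (app (isos g) (tupT (vsT ys))) (tupT (vsT (xs′ V.++ ys′)))
  rest′ = lett (tupP ys′) (app (isos g) (tupT EB)) (tupT (vsT (xs′ V.++ ys′)))
  split-input : map enc ns ≡ EA V.++ EB
  split-input = trans (cong (map enc) (sym (VP.take++drop≡id J ns))) (VP.map-++ enc as bs)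
  matches : Match σ (tupT (vsT (xs V.++ ys))) (tupT (EA V.++ EB))
  matches = subst₂ (λ σ′ xs″ → Match σ′ (tupT (vsT xs″)) (tupT (EA V.++ EB)))
                   (bindFrom-++ 0 EA EB []) (sym (vs-++ 0 J K))
                   (subst (λ zs → Match (bindFrom 0 zs []) (tupT (vsT (vs 0 (J + K)))) (tupT zs))
                          (VP.map-++ enc as bs) (match-vars 0 (encs-value (as V.++ bs))))
  ρ : Subst
  ρ = removeS (patVars (tupP xs′)) σ
  lookup-ys : map (lookupS ρ) ys ≡ EB
  lookup-ys = trans (map-cong-∈ ys skip-xs) (lookupS-bindFrom J EB [])
    where
    skip-xs : ∀ {y} → y ∈ toList ys → lookupS ρ y ≡ lookupS (bindFrom J EB []) y
    skip-xs y∈ys with ∈-vs⁻ J K y∈ys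
    ... | J≤y , y<J+K = trans (lookupS-removeS-∉ _ σ (∉-tupP-vs (J + K) j (inj₁ y<J+K)))
                              (lookupS-bindFrom-beyond 0 EA (bindFrom J EB []) J≤y)
  enter-g : substT ρ rest ≡ rest′
  enter-g = substT-lett-app (tupT (vsT ys)) (tupT (vsT (xs′ V.++ ys′))) (isos-closed g)
              (trans (substT-vars ρ ys) (cong tupT lookup-ys))
              (trans (cong (λ ρ′ → substT ρ′ (tupT (vsT (xs′ V.++ ys′))))
                           (sym (removeS-++ (patVars (tupP xs′)) (patVars (tupP ys′)) σ)))
                     (substT-removeS (tupT (vsT (xs′ V.++ ys′))) σ (vars-scoped (xs′ V.++ ys′) out-scoped)))
    where
    out-scoped : toList (xs′ V.++ ys′) ⊆ patVars (tupP xs′) ++ patVars (tupP ys′)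
    out-scoped {x} x∈ with ∈-++⁻ (toList xs′) (subst (x ∈_) (VP.toList-++ xs′ ys′) x∈)
    ... | inj₁ x∈xs′ = ∈-++⁺ˡ (toList⊆tupP xs′ x∈xs′)
    ... | inj₂ x∈ys′ = ∈-++⁺ʳ (patVars (tupP xs′)) (toList⊆tupP ys′ x∈ys′)
  ρ′ : Subst
  ρ′ = removeS (patVars (tupP ys′)) (bindFrom (J + K) MA [])
  leave-f : substT ρ′ (tupT (vsT (xs′ V.++ ys′))) ≡ tupT (MA V.++ vsT ys′)
  leave-f = trans (substT-vars ρ′ (xs′ V.++ ys′))
                  (cong tupT (trans (VP.map-++ (lookupS ρ′) xs′ ys′)
                                    (cong₂ V._++_ lookup-xs′ (lookupS-removeS-tupP _ ys′))))
    where
    skip-ys′ : ∀ {y} → y ∈ toList xs′ → lookupS ρ′ y ≡ lookupS (bindFrom (J + K) MA []) y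
    skip-ys′ y∈xs′ = lookupS-removeS-∉ _ _ (∉-tupP-vs (J + K + J) k (inj₁ (proj₂ (∈-vs⁻ (J + K) J y∈xs′))))
    lookup-xs′ : map (lookupS ρ′) xs′ ≡ MA
    lookup-xs′ = trans (map-cong-∈ xs′ skip-ys′) (lookupS-bindFrom (J + K) MA [])
  leave-g : substT (bindFrom (J + K + J) MB []) (tupT (MA V.++ vsT ys′)) ≡ tupT (map enc (⟦ f ⟧ as V.++ ⟦ g ⟧ bs))
  leave-g = trans (substT-tupT σ″ (MA V.++ vsT ys′)) (cong tupT
    (trans (VP.map-++ (substT σ″) MA (vsT ys′))
    (trans (cong₂ V._++_ (map-substT-enc σ″ (⟦ f ⟧ as)) lookup-ys′)
           (sym (VP.map-++ enc (⟦ f ⟧ as) (⟦ g ⟧ bs))))))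
    where
    σ″ : Subst
    σ″ = bindFrom (J + K + J) MB []
    lookup-ys′ : map (substT σ″) (vsT ys′) ≡ MB
    lookup-ys′ = trans (sym (VP.map-∘ (substT σ″) var ys′)) (lookupS-bindFrom (J + K + J) MB [])

simulates-∷ʳ : ∀ {k} (f : RPP (suc k)) (F : Vec ℤ k → ℤ → Vec ℤ k) →
  (∀ as c → ⟦ f ⟧ (as ∷ʳ c) ≡ F as c ∷ʳ c) →
  (∀ as c → app (isos f) (tupT (map enc as ∷ʳ enc c)) ⟶* tupT (map enc (F as c) ∷ʳ enc c)) →
  Simulates f
simulates-∷ʳ f F ⟦f⟧≡ sim ns with V.initLast ns
... | as , c , refl = subst₂ (λ t u → app (isos f) t ⟶* u)
  (cong tupT (sym (VP.map-∷ʳ enc c as)))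
  (cong tupT (trans (sym (VP.map-∷ʳ enc c (F as c))) (cong (map enc) (sym (⟦f⟧≡ as c)))))
  (sim as c)

select-elim : ∀ {A : Set} (Q : A → Set) c {a b d} → Q a → Q b → Q d → Q (select c a b d)
select-elim Q (+ zero)  qa qb qd = qb
select-elim Q (+ suc _) qa qb qd = qa
select-elim Q -[1+ _ ]  qa qb qd = qd

simulates-If : ∀ {k} (f g h : RPP (suc k)) → Simulates f → Simulates g → Simulates h → Simulates (If f g h)
simulates-If {k} f g h sim-f sim-g sim-h = simulates-∷ʳ (If f g h) F ⟦If⟧≡ branch
  where
  K : ℕ
  K = suc k
  F : Vec ℤ K → ℤ → Vec ℤ K
  F as c = select c (⟦ f ⟧ as) (⟦ g ⟧ as) (⟦ h ⟧ as)
  ⟦If⟧≡ : ∀ as c → ⟦ If f g h ⟧ (as ∷ʳ c) ≡ F as c ∷ʳ c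
  ⟦If⟧≡ as c = cong₂ (λ as′ c′ → F as′ c′ ∷ʳ c′) (VP.init-∷ʳ c as) (VP.last-∷ʳ c as)
  xs xs′ : Vec ℕ K
  xs  = vs 0 K
  xs′ = vs K K
  z : ℕ
  z = 2 * K
  ω : ℤ → Iso
  ω c = select c (isos f) (isos g) (isos h)
  clause∈ : ∀ c → (tupT (vsT xs ∷ʳ counterPat z c) ,
                   lett (tupP xs′) (app (ω c) (tupT (vsT xs))) (tupT (vsT xs′ ∷ʳ counterPat z c)))
                  ∈ clausesOf (isos (If f g h))
  clause∈ (+ zero)  = there (here refl)
  clause∈ (+ suc _) = here refl
  clause∈ -[1+ _ ]  = there (there (here refl))
  ω-simulates : ∀ as c → app (ω c) (tupT (map enc as)) ⟶* tupT (map enc (F as c))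
  ω-simulates as (+ zero)  = sim-g as
  ω-simulates as (+ suc _) = sim-f as
  ω-simulates as -[1+ _ ]  = sim-h as
  branch : ∀ as c → app (isos (If f g h)) (tupT (map enc as ∷ʳ enc c)) ⟶* tupT (map enc (F as c) ∷ʳ enc c)
  branch as c = begin
    app (isos (If f g h)) (tupT (E ∷ʳ enc c))
      ⟶⟨ β-iso (tupT-value (All-∷ʳ (encs-value as) (enc-value c))) (clause∈ c)
                (match-vars-∷ʳ 0 (encs-value as) (match-counterPat z c) z-fresh) ⟩
    substT σ (lett (tupP xs′) (app (ω c) (tupT (vsT xs))) (tupT (vsT xs′ ∷ʳ counterPat z c)))
      ≡⟨ substT-lett-app (tupT (vsT xs)) (tupT (vsT xs′ ∷ʳ counterPat z c))
                         (select-elim ClosedIso c (isos-closed f) (isos-closed g) (isos-closed h))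
                         (substT-bound-vars 0 E (counterSubst z c)) counter-kept ⟩
    lett (tupP xs′) (app (ω c) (tupT E)) (tupT (vsT xs′ ∷ʳ enc c))
      ⟶*⟨ lett-cong* (ω-simulates as c) ⟩
    lett (tupP xs′) (tupT M) (tupT (vsT xs′ ∷ʳ enc c))
      ⟶⟨ β-let-vars K k (encs-value _) ⟩
    substT (bindFrom K M []) (tupT (vsT xs′ ∷ʳ enc c))
      ≡⟨ trans (substT-bound-vars-∷ʳ K M [] (enc c)) (cong (λ t → tupT (M ∷ʳ t)) (substT-enc _ c)) ⟩
    tupT (M ∷ʳ enc c) ∎
    where
    open StarReasoning _⟶_
    E M : Vec Term K
    E = map enc as
    M = map enc (F as c)
    σ ρ : Subst
    σ = bindFrom 0 E (counterSubst z c)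
    ρ = removeS (patVars (tupP xs′)) σ
    z-fresh : ∀ {y} → y ∈ dom (counterSubst z c) → 0 + K ≤ y
    z-fresh y∈ rewrite counterSubst-dom z c y∈ = m≤m+n K _
    counter-kept : substT ρ (tupT (vsT xs′ ∷ʳ counterPat z c)) ≡ tupT (vsT xs′ ∷ʳ enc c)
    counter-kept = trans (substT-vars-∷ʳ ρ xs′ (counterPat z c))
      (cong₂ (λ us t → tupT (us ∷ʳ t)) (lookupS-removeS-tupP σ xs′)
        (substT-counterPat ρ z c (trans (lookupS-removeS-∉ _ σ (∉-tupP-vs {z} K k (inj₂ (+-monoʳ-≤ K (m≤m+n K 0)))))
                                        (lookupS-bindFrom-beyond 0 E (counterSubst z c) (m≤m+n K _)))))

auxClauses-unfold : ∀ {k} (f : RPP k) W → isubC 0 W (auxClauses f (ivar 0)) ≡ auxClauses f W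
auxClauses-unfold {k} f W
  rewrite proj₂ (isos-closed f) W
        | isubT-value {0} {W} (tupT-value (vars-value (vs 0 k)))
        | isubT-value {0} {W} (tupT-value (All-∷ʳ (vars-value (vs k k)) (v-fold (v-inl v-unit))))
        | isubT-value {0} {W} (tupT-value (All-∷ʳ (vars-value (vs k k)) (v-var {3 * k})))
        | isubT-value {0} {W} (tupT-value (All-∷ʳ (vars-value (vs (2 * k) k)) (v-fold (v-inr (v-var {suc (3 * k)})))))
  = refl

iter-suc : ∀ {A : Set} m (F : A → A) a → iter m F (F a) ≡ F (iter m F a)
iter-suc zero    F a = refl
iter-suc (suc m) F a = cong F (iter-suc m F a)

ωaux-simulates : ∀ {k} (f : RPP (suc k)) → Simulates f → ∀ m (as : Vec ℤ (suc k)) →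
  app (ωaux f) (tupT (map enc as ∷ʳ under m)) ⟶* tupT (map enc (iter (suc m) ⟦ f ⟧ as) ∷ʳ under m)
ωaux-simulates {k} f sim-f m as = begin
  app (ωaux f) (tupT (E ∷ʳ under m))
    ⟶⟨ β-fix ⟩
  app (clauses (isubC 0 (ωaux f) (auxClauses f (ivar 0)))) (tupT (E ∷ʳ under m))
    ≡⟨ cong (λ cs → app (clauses cs) (tupT (E ∷ʳ under m))) (auxClauses-unfold f (ωaux f)) ⟩
  app (clauses (auxClauses f (ωaux f))) (tupT (E ∷ʳ under m))
    ⟶*⟨ run-clauses m ⟩
  tupT (map enc (iter (suc m) ⟦ f ⟧ as) ∷ʳ under m) ∎
  where
  open StarReasoning _⟶_
  K : ℕ
  K = suc k
  xs ys zs : Vec ℕ K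
  xs = vs 0 K
  ys = vs K K
  zs = vs (2 * K) K
  E M : Vec Term K
  E = map enc as
  M = map enc (⟦ f ⟧ as)
  run-clauses : ∀ m → app (clauses (auxClauses f (ωaux f))) (tupT (E ∷ʳ under m)) ⟶*
                      tupT (map enc (iter (suc m) ⟦ f ⟧ as) ∷ʳ under m)
  run-clauses zero = begin
    app (clauses (auxClauses f (ωaux f))) (tupT (E ∷ʳ under 0))
      ⟶⟨ β-iso (tupT-value (All-∷ʳ (encs-value as) (under-value 0))) (here refl)
               (match-vars-∷ʳ 0 (encs-value as) (m-fold (m-inl m-unit)) λ ()) ⟩
    substT (bindFrom 0 E []) (lett (tupP ys) (app (isos f) (tupT (vsT xs))) (tupT (vsT ys ∷ʳ under 0)))
      ≡⟨ substT-lett-app (tupT (vsT xs)) (tupT (vsT ys ∷ʳ under 0)) (isos-closed f) (substT-bound-vars 0 E [])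
                         (substT-removeS (tupT (vsT ys ∷ʳ under 0)) (bindFrom 0 E [])
                                         (vars-∷ʳ-scoped ys (under-value 0) (toList⊆tupP ys) λ ())) ⟩
    lett (tupP ys) (app (isos f) (tupT E)) (tupT (vsT ys ∷ʳ under 0))
      ⟶*⟨ lett-cong* (sim-f as) ⟩
    lett (tupP ys) (tupT M) (tupT (vsT ys ∷ʳ under 0))
      ⟶⟨ β-let-vars K k (encs-value _) ⟩
    substT (bindFrom K M []) (tupT (vsT ys ∷ʳ under 0))
      ≡⟨ substT-bound-vars-∷ʳ K M [] (under 0) ⟩
    tupT (M ∷ʳ under 0) ∎
  run-clauses (suc m) = begin
    app (clauses (auxClauses f (ωaux f))) (tupT (E ∷ʳ under (suc m)))
      ⟶⟨ β-iso (tupT-value (All-∷ʳ (encs-value as) (under-value (suc m)))) (there (here refl))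
               (match-vars-∷ʳ 0 (encs-value as) (m-fold (m-inr (m-var (under-value m)))) λ { (here refl) → K≤n }) ⟩
    substT σ (lett (tupP ys) (app (isos f) (tupT (vsT xs))) (loop (tupT (vsT ys ∷ʳ var n))))
      ≡⟨ substT-lett-app (tupT (vsT xs)) (loop (tupT (vsT ys ∷ʳ var n))) (isos-closed f) (substT-bound-vars 0 E _)
           (substT-lett-app (tupT (vsT ys ∷ʳ var n)) loop-result aux-closed count-passed
                            (substT-removeS loop-result ρ loop-result-scoped)) ⟩
    lett (tupP ys) (app (isos f) (tupT E)) (loop (tupT (vsT ys ∷ʳ u)))
      ⟶*⟨ lett-cong* (sim-f as) ⟩
    lett (tupP ys) (tupT M) (loop (tupT (vsT ys ∷ʳ u)))
      ⟶⟨ β-let-vars K k (encs-value _) ⟩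
    substT (bindFrom K M []) (loop (tupT (vsT ys ∷ʳ u)))
      ≡⟨ substT-lett-app (tupT (vsT ys ∷ʳ u)) loop-result aux-closed
           (trans (substT-bound-vars-∷ʳ K M [] u) (cong (λ t → tupT (M ∷ʳ t)) (substT-under _ m)))
           (substT-removeS loop-result (bindFrom K M []) loop-result-scoped) ⟩
    loop (tupT (M ∷ʳ u))
      ⟶*⟨ lett-cong* (ωaux-simulates f sim-f m (⟦ f ⟧ as)) ⟩
    lett (tupP (zs ∷ʳ n′)) (tupT (R ∷ʳ u)) loop-result
      ⟶⟨ β-let-vars-∷ʳ (2 * K) K n′ (encs-value _) (under-value m) 2K+K≤n′ ⟩
    substT (bindFrom (2 * K) R ((n′ , u) ∷ [])) loop-result
      ≡⟨ trans (substT-bound-vars-∷ʳ (2 * K) R _ _)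
               (cong₂ (λ us t → tupT (us ∷ʳ fold (inr t)))
                      (cong (map enc) (iter-suc (suc m) ⟦ f ⟧ as))
                      (trans (lookupS-bindFrom-beyond (2 * K) R _ 2K+K≤n′) (lookupS-here n′ u []))) ⟩
    tupT (map enc (iter (suc (suc m)) ⟦ f ⟧ as) ∷ʳ under (suc m)) ∎
    where
    n n′ : ℕ
    n  = 3 * K
    n′ = suc n
    u : Term
    u = under m
    R : Vec Term K
    R = map enc (iter (suc m) ⟦ f ⟧ (⟦ f ⟧ as))
    σ ρ : Subst
    σ = bindFrom 0 E ((n , u) ∷ [])
    ρ = removeS (patVars (tupP ys)) σ
    K≤n : 0 + K ≤ n
    K≤n = m≤m+n K _
    2K+K≤n′ : 2 * K + K ≤ n′
    2K+K≤n′ = ≤-trans (≤-reflexive (+-comm (2 * K) K)) (n≤1+n n)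
    aux-closed : ClosedIso (ωaux f)
    aux-closed = ωaux-closed f (proj₁ (isos-closed f))
    loop-result : Term
    loop-result = tupT (vsT zs ∷ʳ fold (inr (var n′)))
    loop-result-scoped : Scoped ClosedIso (patVars (tupP (zs ∷ʳ n′))) loop-result
    loop-result-scoped = vars-∷ʳ-scoped zs (v-fold (v-inr v-var)) (tupP-init zs n′) λ { (here refl) → tupP-last zs n′ }
    loop : Term → Term
    loop a = lett (tupP (zs ∷ʳ n′)) (app (ωaux f) a) loop-result
    count-passed : substT ρ (tupT (vsT ys ∷ʳ var n)) ≡ tupT (vsT ys ∷ʳ u)
    count-passed = trans (substT-vars-∷ʳ ρ ys (var n)) (cong₂ (λ us t → tupT (us ∷ʳ t)) (lookupS-removeS-tupP σ ys)
      (trans (lookupS-removeS-∉ _ σ (∉-tupP-vs {n} K k (inj₂ (+-monoʳ-≤ K (m≤m+n K _)))))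
             (trans (lookupS-bindFrom-beyond 0 E _ K≤n) (lookupS-here n u []))))

simulates-It : ∀ {k} (f : RPP (suc k)) → Simulates f → Simulates (It f)
simulates-It {k} f sim-f = simulates-∷ʳ (It f) F ⟦It⟧≡ counting
  where
  open StarReasoning _⟶_
  K : ℕ
  K = suc k
  F : Vec ℤ K → ℤ → Vec ℤ K
  F as c = iter ∣ c ∣ ⟦ f ⟧ as
  ⟦It⟧≡ : ∀ as c → ⟦ It f ⟧ (as ∷ʳ c) ≡ F as c ∷ʳ c
  ⟦It⟧≡ as c = cong₂ (λ as′ c′ → F as′ c′ ∷ʳ c′) (VP.init-∷ʳ c as) (VP.last-∷ʳ c as)
  xs ys : Vec ℕ K
  xs = vs 0 K
  ys = vs K K
  z z′ : ℕ
  z  = 2 * K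
  z′ = suc (2 * K)
  nonzero : ∀ as c m →
    (tupT (vsT xs ∷ʳ counterPat z c) ,
     lett (tupP (ys ∷ʳ z′)) (app (ωaux f) (tupT (vsT xs ∷ʳ var z))) (tupT (vsT ys ∷ʳ counterPat z′ c)))
      ∈ clausesOf (isos (It f)) →
    ∣ c ∣ ≡ suc m → (∀ x → counterSubst x c ≡ (x , under m) ∷ []) →
    app (isos (It f)) (tupT (map enc as ∷ʳ enc c)) ⟶* tupT (map enc (F as c) ∷ʳ enc c)
  nonzero as c m clause∈ ∣c∣≡ counterSubst≡ = begin
    app (isos (It f)) (tupT (E ∷ʳ enc c))
      ⟶⟨ β-iso (tupT-value (All-∷ʳ (encs-value as) (enc-value c))) clause∈
               (match-vars-∷ʳ 0 (encs-value as) (match-counterPat z c) z-fresh) ⟩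
    substT σ (lett (tupP (ys ∷ʳ z′)) (app (ωaux f) (tupT (vsT xs ∷ʳ var z))) (tupT (vsT ys ∷ʳ counterPat z′ c)))
      ≡⟨ substT-lett-app (tupT (vsT xs ∷ʳ var z)) (tupT (vsT ys ∷ʳ counterPat z′ c))
                         (ωaux-closed f (proj₁ (isos-closed f))) count-passed
                         (substT-removeS (tupT (vsT ys ∷ʳ counterPat z′ c)) σ result-scoped) ⟩
    lett (tupP (ys ∷ʳ z′)) (app (ωaux f) (tupT (E ∷ʳ under m))) (tupT (vsT ys ∷ʳ counterPat z′ c))
      ⟶*⟨ lett-cong* (ωaux-simulates f sim-f m as) ⟩
    lett (tupP (ys ∷ʳ z′)) (tupT (M ∷ʳ under m)) (tupT (vsT ys ∷ʳ counterPat z′ c))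
      ⟶⟨ β-let-vars-∷ʳ K K z′ (encs-value _) (under-value m) K+K≤z′ ⟩
    substT σ′ (tupT (vsT ys ∷ʳ counterPat z′ c))
      ≡⟨ trans (substT-bound-vars-∷ʳ K M _ (counterPat z′ c)) (cong (λ t → tupT (M ∷ʳ t))
           (substT-counterPat σ′ z′ c (trans (lookupS-bindFrom-beyond K M _ K+K≤z′)
                                             (cong (λ τ → lookupS τ z′) (sym (counterSubst≡ z′)))))) ⟩
    tupT (M ∷ʳ enc c)
      ≡⟨ cong (λ i → tupT (map enc (iter i ⟦ f ⟧ as) ∷ʳ enc c)) (sym ∣c∣≡) ⟩
    tupT (map enc (F as c) ∷ʳ enc c) ∎
    where
    E M : Vec Term K
    E = map enc as
    M = map enc (iter (suc m) ⟦ f ⟧ as)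
    σ σ′ : Subst
    σ  = bindFrom 0 E (counterSubst z c)
    σ′ = bindFrom K M ((z′ , under m) ∷ [])
    z-fresh : ∀ {y} → y ∈ dom (counterSubst z c) → 0 + K ≤ y
    z-fresh y∈ rewrite counterSubst-dom z c y∈ = m≤m+n K _
    K+K≤z′ : K + K ≤ z′
    K+K≤z′ = ≤-trans (+-monoʳ-≤ K (m≤m+n K 0)) (n≤1+n z)
    count-passed : substT σ (tupT (vsT xs ∷ʳ var z)) ≡ tupT (E ∷ʳ under m)
    count-passed = trans (substT-bound-vars-∷ʳ 0 E (counterSubst z c) (var z)) (cong (λ t → tupT (E ∷ʳ t))
      (trans (lookupS-bindFrom-beyond 0 E (counterSubst z c) (m≤m+n K _))
             (trans (cong (λ τ → lookupS τ z) (counterSubst≡ z)) (lookupS-here z (under m) []))))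
    result-scoped : Scoped ClosedIso (patVars (tupP (ys ∷ʳ z′))) (tupT (vsT ys ∷ʳ counterPat z′ c))
    result-scoped = vars-∷ʳ-scoped ys (counterPat-value z′ c) (tupP-init ys z′) (bound ∘ counterPat-vars z′ c)
      where
      bound : z′ ∷ [] ⊆ patVars (tupP (ys ∷ʳ z′))
      bound (here refl) = tupP-last ys z′
  counting : ∀ as c → app (isos (It f)) (tupT (map enc as ∷ʳ enc c)) ⟶* tupT (map enc (F as c) ∷ʳ enc c)
  counting as (+ zero)  = begin
    app (isos (It f)) (tupT (map enc as ∷ʳ inl unit))
      ⟶⟨ β-iso (tupT-value (All-∷ʳ (encs-value as) (v-inl v-unit))) (here refl)
               (match-vars-∷ʳ 0 (encs-value as) (m-inl m-unit) λ ()) ⟩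
    substT (bindFrom 0 (map enc as) []) (tupT (vsT xs ∷ʳ inl unit))
      ≡⟨ substT-bound-vars-∷ʳ 0 (map enc as) [] (inl unit) ⟩
    tupT (map enc as ∷ʳ inl unit) ∎
  counting as (+ suc m) = nonzero as (+ suc m) m (there (here refl)) refl (λ _ → refl)
  counting as -[1+ m ]  = nonzero as -[1+ m ] m (there (there (here refl))) refl (λ _ → refl)

arity-suc : ∀ {k} → RPP k → ∃ λ n → k ≡ suc n
arity-suc S    = 0 , refl
arity-suc P    = 0 , refl
arity-suc Id   = 0 , refl
arity-suc Sign = 0 , refl
arity-suc X    = 1 , refl
arity-suc (f ⨾ g) = arity-suc f
arity-suc (_∥_ {l = l} f g) with arity-suc f
... | n , refl = n + l , refl
arity-suc (It {k} f)     = k , refl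
arity-suc (If {k} f g h) = k , refl

no-nullary : ¬ RPP 0
no-nullary f with arity-suc f
... | _ , ()

mainTheorem9 : ∀ {k : ℕ} (f : RPP k) (ns : Vec ℤ k) →
    app (isos f) (tupT (map enc ns)) ⟶* tupT (map enc (⟦ f ⟧ ns))
mainTheorem9 S    = simulates-S
mainTheorem9 P    = simulates-P
mainTheorem9 Id   = simulates-Id
mainTheorem9 Sign = simulates-Sign
mainTheorem9 X    = simulates-X
mainTheorem9 (_⨾_ {suc k} f g)          = simulates-⨾ f g (mainTheorem9 f) (mainTheorem9 g)
mainTheorem9 (_∥_ {suc j} {suc k} f g)  = simulates-∥ f g (mainTheorem9 f) (mainTheorem9 g)
mainTheorem9 (It {suc k} f)             = simulates-It f (mainTheorem9 f)
mainTheorem9 (If {suc k} f g h)         = simulates-If f g h (mainTheorem9 f) (mainTheorem9 g) (mainTheorem9 h)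
mainTheorem9 (_⨾_ {zero} f g)           = ⊥-elim (no-nullary f)
mainTheorem9 (_∥_ {zero} f g)           = ⊥-elim (no-nullary f)
mainTheorem9 (_∥_ {suc j} {zero} f g)   = ⊥-elim (no-nullary g)
mainTheorem9 (It {zero} f)              = ⊥-elim (no-nullary f)
mainTheorem9 (If {zero} f g h)          = ⊥-elim (no-nullary f)
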